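{- Let $G$ be a caterpillar with $n$ vertices. Then the burning number of $G$ satisfies $b(G)\leq \left\lceil\sqrt{n}\right\rceil$.
   Context: All graphs are finite, simple and undirected. Burning a graph $G$ proceeds in discrete rounds: in round $1$ one vertex is set on fire; in each subsequent round, first the fire spreads from every burning vertex to all its neighbours, and then one additional (not necessarily non-burning) vertex may be set on fire. Burning vertices stay burning. The burning number $b(G)$ is the minimum number of rounds after which all vertices are burning. Equivalently, $b(G)$ is the least $k$ for which there are vertices $x_1,\dots,x_k$ such that every vertex of $G$ is at distance at most $k-i$ from $x_i$ for some $i\in\{1,\dots,k\}$. A caterpillar is a tree in which every vertex is at distance at most one from a central path (the spine); equivalently, a tree that becomes a path when all its leaves are removed. -}

module Defs where

open import Level using (0ℓ)
open import Data.Nat using (ℕ; zero; suc; _+_; _*_; _∸_; _≤_; _≤?_; _<_)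
open import Data.Fin using (Fin; toℕ)
open import Data.List using (List; []; _∷_; length)
open import Data.List.Relation.Unary.Unique.Propositional using (Unique)
open import Data.List.Relation.Unary.Any using (Any)
open import Data.List.Membership.Propositional using (_∈_)
open import Data.Product using (Σ; ∃; _×_; _,_)
open import Data.Sum using (_⊎_)
open import Relation.Nullary using (¬_; yes; no)

record Graph (n : ℕ) : Set₁ where
  field
    Adj     : Fin n → Fin n → Set
    sym     : ∀ {u v} → Adj u v → Adj v u
    irrefl  : ∀ {u} → ¬ Adj u u
open Graph public

module _ {n : ℕ} (G : Graph n) where

  data Walk : Fin n → Fin n → ℕ → Set where
    here : ∀ {u} → Walk u u 0
    step : ∀ {u v w l} → Adj G u v → Walk v w l → Walk u w (suc l)

  DistLe : Fin n → Fin n → ℕ → Set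
  DistLe u v k = ∃ λ l → l ≤ k × Walk u v l

  Connected : Set
  Connected = ∀ u v → ∃ λ l → Walk u v l

  Chain : List (Fin n) → Set
  Chain []           = Data.Unit.⊤ where import Data.Unit
  Chain (x ∷ [])     = Data.Unit.⊤ where import Data.Unit
  Chain (x ∷ y ∷ xs) = Adj G x y × Chain (y ∷ xs)

  last : Fin n → List (Fin n) → Fin n
  last x []       = x
  last x (y ∷ ys) = last y ys

  IsPath : List (Fin n) → Set
  IsPath vs = Chain vs × Unique vs

  IsCycle : Fin n → List (Fin n) → Set
  IsCycle x xs = IsPath (x ∷ xs) × 2 ≤ length xs × Adj G (last x xs) x

  Acyclic : Set
  Acyclic = ∀ x xs → ¬ IsCycle x xs

  IsTree : Set
  IsTree = Connected × Acyclic

  IsCaterpillar : Set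
  IsCaterpillar = IsTree × ∃ λ spine → IsPath spine ×
                    (∀ v → v ∈ spine ⊎ Any (Adj G v) spine)

  -- burning sequence of length k: x_0 … x_{k-1} (0-indexed; x_i is the
  -- paper's x_{i+1}), every vertex within distance k - (i+1) of some x_i
  BurningSeq : (k : ℕ) → (Fin k → Fin n) → Set
  BurningSeq k x = ∀ v → ∃ λ (i : Fin k) → DistLe (x i) v (k ∸ suc (toℕ i))

  Burnable : ℕ → Set
  Burnable k = ∃ λ (x : Fin k → Fin n) → BurningSeq k x

  -- b(G) ≤ m  ⟺  G is burnable within some k ≤ m rounds (b(G) is the least such k)
  BurningNumberLe : ℕ → Set
  BurningNumberLe m = ∃ λ k → k ≤ m × Burnable k

-- ⌈√n⌉ : the least s with n ≤ s * s (search with fuel; s = n always works)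
ceilSqrtFrom : ℕ → ℕ → ℕ → ℕ
ceilSqrtFrom n s zero = s
ceilSqrtFrom n s (suc fuel) with n ≤? s * s
... | yes _ = s
... | no  _ = ceilSqrtFrom n (suc s) fuel

ceilSqrt : ℕ → ℕ
ceilSqrt n = ceilSqrtFrom n 0 n

-- Only the dominating path (the spine) of the caterpillar is used. Number the spine vertices
-- 0, …, m − 1, let every other vertex hang from one adjacent spine vertex, and call a position
-- heavy when something hangs from it; appending one hanging vertex to the spine if necessary, the
-- last position is light. The spine together with one hanging vertex per heavy position consists
-- of distinct vertices, so the mass m + #heavy is at most n ≤ k² for k = ⌈√n⌉. A fire of radius R
-- centred on the spine burns a whole heavy position (its spine vertex and all hanging vertices)
-- within distance R − 1, and a light one within distance R. Fires of radii k − 1, k − 2, … are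
-- laid from left to right, each as far right as possible. A fire of radius R then burns mass at
-- least 2R + 1, unless its block stops just before a heavy position; in that case the radii R − 1
-- and R, used in this order, burn mass at least 4R = (2R − 1) + (2R + 1). Either way the mass left
-- over stays within the square of the number of unused radii.

module Submission where

open import Defs hiding (sym)
open import Data.Bool using (Bool; true; false; if_then_else_)
open import Data.Bool.Properties using (¬-not)
open import Data.Empty using (⊥-elim)
open import Data.Fin using (Fin; toℕ; fromℕ<) renaming (zero to fzero; suc to fsuc)
open import Data.Fin.Properties using (toℕ-fromℕ<; injective⇒≤; any?)
import Data.Fin.Properties as Fin
open import Data.List using (List; []; _∷_; _++_; length; lookup)
open import Data.List.Properties using (length-++)
open import Data.List.Relation.Unary.Any using (Any; here; there)
open import Data.List.Relation.Unary.All as All using (All; []; _∷_)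
import Data.List.Relation.Unary.All.Properties as All
open import Data.List.Relation.Unary.AllPairs using ([]; _∷_)
open import Data.List.Relation.Unary.Unique.Propositional using (Unique)
import Data.List.Relation.Unary.Unique.Propositional.Properties as Unique
open import Data.List.Membership.Propositional using (_∈_; _∉_)
open import Data.List.Membership.Propositional.Properties using (∈-lookup; ∈-++⁺ˡ)
open import Data.Nat
open import Data.Nat.Properties
open import Data.Nat.Tactic.RingSolver using (solve-∀)
open import Algebra.Properties.CommutativeSemigroup +-commutativeSemigroup using (x∙yz≈y∙xz)
open import Data.Product using (Σ; ∃; _×_; _,_; proj₁; proj₂)
open import Data.Sum using (_⊎_; inj₁; inj₂; [_,_]′)
open import Data.Unit using (tt)
open import Function using (_∘_)
open import Relation.Binary.PropositionalEquality
open import Relation.Nullary using (¬_; Dec; yes; no; ¬?)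
open import Relation.Nullary.Decidable using (_×-dec_)

bit : Bool → ℕ
bit false = 0
bit true  = 1

bit≤1 : ∀ b → bit b ≤ 1
bit≤1 false = z≤n
bit≤1 true  = ≤-refl

bit≡0 : ∀ {b} → bit b ≡ 0 → b ≡ false
bit≡0 {false} _ = refl

pred[n]<n : ∀ {n} → 0 < n → pred n < n
pred[n]<n {suc n} _ = n<1+n n

_[_≔_] : ∀ {A : Set} → (ℕ → A) → ℕ → A → ℕ → A
(f [ R ≔ c ]) x with x ≟ R
... | yes _ = c
... | no  _ = f x

≔-same : ∀ {A : Set} (f : ℕ → A) R {c} → (f [ R ≔ c ]) R ≡ c
≔-same f R with R ≟ R
... | yes _  = refl
... | no R≢R = ⊥-elim (R≢R refl)

≔-other : ∀ {A : Set} {R c x} (f : ℕ → A) → x ≢ R → (f [ R ≔ c ]) x ≡ f x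
≔-other {R = R} {x = x} f x≢R with x ≟ R
... | yes x≡R = ⊥-elim (x≢R x≡R)
... | no  _   = refl

budget-after : ∀ x d {y z e} → x + d ≤ y → z ≤ x + (d + e) → z ≤ y + e
budget-after x d {y} {z} {e} used budget = begin
  z              ≤⟨ budget ⟩
  x + (d + e)    ≡⟨ +-assoc x d e ⟨
  x + d + e      ≤⟨ +-monoˡ-≤ e used ⟩
  y + e          ∎
  where open ≤-Reasoning

module Covering (m : ℕ) (heavy : ℕ → Bool)
                (last-light : ∀ p → m ≤ suc p → heavy p ≡ false) where

  -- Positions 0, …, m − 1 lie along the spine and `heavy p` says that vertices hang from p;
  -- `mass a` counts the positions below a, heavy ones twice.
  mass : ℕ → ℕ
  mass zero    = zero
  mass (suc a) = suc (bit (heavy a) + mass a)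

  mass-suc-heavy : ∀ {a} → heavy a ≡ true → mass (suc a) ≡ 2 + mass a
  mass-suc-heavy eq rewrite eq = refl

  mass-suc-light : ∀ {a} → heavy a ≡ false → mass (suc a) ≡ 1 + mass a
  mass-suc-light eq rewrite eq = refl

  mass-< : ∀ a → mass a < mass (suc a)
  mass-< a = s≤s (m≤n+m (mass a) (bit (heavy a)))

  mass-+ : ∀ a d → mass a + d ≤ mass (a + d)
  mass-+ a zero    rewrite +-identityʳ a | +-identityʳ (mass a) = ≤-refl
  mass-+ a (suc d) = begin
    mass a + suc d      ≡⟨ +-suc (mass a) d ⟩
    suc (mass a + d)    ≤⟨ s≤s (mass-+ a d) ⟩
    suc (mass (a + d))  ≤⟨ mass-< (a + d) ⟩
    mass (suc (a + d))  ≡⟨ cong mass (sym (+-suc a d)) ⟩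
    mass (a + suc d)    ∎
    where open ≤-Reasoning

  mass-mono : ∀ {a b} → a ≤ b → mass a ≤ mass b
  mass-mono {a} a≤b with d , refl ← m≤n⇒∃[o]m+o≡n a≤b =
    ≤-trans (m≤m+n (mass a) d) (mass-+ a d)

  -- A fire of radius R ≥ bit (heavy a) that must burn position a entirely is centred as far right
  -- as possible; it burns the positions a, …, end a R, all of them entirely except possibly the
  -- last, so `next a R` is the first position it does not burn entirely.
  centre : ℕ → ℕ → ℕ
  centre a R = if heavy a then a + pred R else a + R

  end : ℕ → ℕ → ℕ
  end a R = centre a R + R

  next : ℕ → ℕ → ℕ
  next a R = if heavy (end a R) then end a R else suc (end a R)

  Good : ℕ → ℕ → Set
  Good a R = mass a + suc (R + R) ≤ mass (next a R)

  good? : ∀ a R → Dec (Good a R)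
  good? a R = _ ≤? _

  -- A fire of radius R at position c burns the spine vertex at p and everything hanging from it.
  Burns : ℕ → ℕ → ℕ → Set
  Burns c R p = bit (heavy p) + c ≤ p + R × bit (heavy p) + p ≤ c + R

  end≤next : ∀ a R → end a R ≤ next a R
  end≤next a R with heavy (end a R)
  ... | true  = ≤-refl
  ... | false = n≤1+n _

  next-if-end-heavy : ∀ {a R} → heavy (end a R) ≡ true → next a R ≡ end a R
  next-if-end-heavy eq rewrite eq = refl

  next-if-end-light : ∀ {a R} → heavy (end a R) ≡ false → next a R ≡ suc (end a R)
  next-if-end-light eq rewrite eq = refl

  end-if-light : ∀ {a R} → heavy a ≡ false → end a R ≡ a + R + R
  end-if-light eq rewrite eq = refl

  end-suc : ∀ {a r} → bit (heavy a) ≤ r → end a (suc r) ≡ suc (suc (end a r))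
  end-suc {a} {r} valid with heavy a
  ... | false = shift a r
    where
    shift : ∀ a r → a + suc r + suc r ≡ suc (suc (a + r + r))
    shift = solve-∀
  end-suc {a} {zero}  ()    | true
  end-suc {a} {suc r} valid | true = shift a r
    where
    shift : ∀ a r → a + suc r + suc (suc r) ≡ suc (suc (a + r + suc r))
    shift = solve-∀

  bit+centre : ∀ {a R} → bit (heavy a) ≤ R → bit (heavy a) + centre a R ≡ a + R
  bit+centre {a} {R} valid with heavy a
  ... | false = refl
  bit+centre {a} {zero}  ()    | true
  bit+centre {a} {suc r} valid | true = sym (+-suc a r)

  bit-shift : ∀ {a p} → a ≤ p → bit (heavy p) + a ≤ bit (heavy a) + p
  bit-shift {a} {p} a≤p with m≤n⇒m<n∨m≡n a≤p
  ... | inj₁ a<p = ≤-trans (+-monoˡ-≤ a (bit≤1 (heavy p))) (≤-trans a<p (m≤n+m p _))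
  ... | inj₂ refl = ≤-refl

  before-next : ∀ {a R p} → p < next a R → bit (heavy p) + p ≤ end a R
  before-next {a} {R} {p} p<next with heavy (end a R) in eq
  ... | true  = ≤-trans (+-monoˡ-≤ p (bit≤1 (heavy p))) p<next
  ... | false with m≤n⇒m<n∨m≡n (≤-pred p<next)
  ...   | inj₁ p<e  = ≤-trans (+-monoˡ-≤ p (bit≤1 (heavy p))) p<e
  ...   | inj₂ refl rewrite eq = ≤-refl

  burns-block : ∀ {a R p} → bit (heavy a) ≤ R → a ≤ p → p < next a R → Burns (centre a R) R p
  burns-block {a} {R} {p} valid a≤p p<next = left , before-next p<next
    where
    open ≤-Reasoning
    left : bit (heavy p) + centre a R ≤ p + R
    left = +-cancelˡ-≤ (bit (heavy a)) _ _ (begin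
      bit (heavy a) + (bit (heavy p) + centre a R)  ≡⟨ x∙yz≈y∙xz (bit (heavy a)) (bit (heavy p)) _ ⟩
      bit (heavy p) + (bit (heavy a) + centre a R)  ≡⟨ cong (bit (heavy p) +_) (bit+centre valid) ⟩
      bit (heavy p) + (a + R)                       ≡⟨ sym (+-assoc (bit (heavy p)) a R) ⟩
      bit (heavy p) + a + R                         ≤⟨ +-monoˡ-≤ R (bit-shift a≤p) ⟩
      bit (heavy a) + p + R                         ≡⟨ +-assoc (bit (heavy a)) p R ⟩
      bit (heavy a) + (p + R)                       ∎)

  burns-radius : ∀ {c R p} → Burns c R p → bit (heavy p) ≤ R
  burns-radius {c} {R} {p} (lo , hi) with heavy p
  ... | false = z≤n
  burns-radius {c} {suc R} {p} (lo , hi) | true = s≤s z≤n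
  burns-radius {c} {zero}  {p} (lo , hi) | true =
    ⊥-elim (<-asym (subst (c <_) (+-identityʳ p) lo) (subst (p <_) (+-identityʳ c) hi))

  burns-spine : ∀ {c R p} → Burns c R p → c ≤ p + R × p ≤ c + R
  burns-spine {p = p} (lo , hi) = m+n≤o⇒n≤o (bit (heavy p)) lo , m+n≤o⇒n≤o (bit (heavy p)) hi

  burns-leaves : ∀ {c R p} → heavy p ≡ true → Burns c R p →
    ∃ λ R′ → R ≡ suc R′ × c ≤ p + R′ × p ≤ c + R′
  burns-leaves {c} {zero}   {p} eq burns with () ← subst (λ b → bit b ≤ 0) eq (burns-radius burns)
  burns-leaves {c} {suc R′} {p} eq (lo , hi) rewrite eq =
    R′ , refl ,
    ≤-pred (subst (suc c ≤_) (+-suc p R′) lo) , ≤-pred (subst (suc p ≤_) (+-suc c R′) hi)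

  burns-clamp : ∀ {c R p} → p < m → Burns c R p → Burns (c ⊓ pred m) R p
  burns-clamp {c} {R} {p} p<m burns@(lo , hi) with ≤-total c (pred m)
  ... | inj₁ c≤m′ rewrite m≤n⇒m⊓n≡m c≤m′ = burns
  ... | inj₂ m′≤c rewrite m≥n⇒m⊓n≡n m′≤c =
    ≤-trans (+-monoʳ-≤ (bit (heavy p)) m′≤c) lo ,
    ≤-trans (≤-reflexive (+-comm (bit (heavy p)) p)) (+-mono-≤ (<⇒≤pred p<m) (burns-radius burns))

  mass-end : ∀ {a R} → bit (heavy a) ≤ R → mass a + (R + R) ≤ mass (end a R)
  mass-end {a} {R} valid with heavy a in eq
  ... | false = subst (λ x → mass a + (R + R) ≤ mass x) (sym (+-assoc a R R)) (mass-+ a (R + R))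
  mass-end {a} {zero}  ()    | true
  mass-end {a} {suc r} valid | true = begin
    mass a + (suc r + suc r)  ≡⟨ regroup (mass a) r ⟩
    2 + mass a + (r + r)      ≡⟨ cong (_+ (r + r)) (sym (mass-suc-heavy eq)) ⟩
    mass (suc a) + (r + r)    ≤⟨ mass-+ (suc a) (r + r) ⟩
    mass (suc a + (r + r))    ≡⟨ cong mass (shift a r) ⟩
    mass (a + r + suc r)      ∎
    where
    open ≤-Reasoning
    regroup : ∀ x r → x + (suc r + suc r) ≡ 2 + x + (r + r)
    regroup = solve-∀
    shift : ∀ a r → suc a + (r + r) ≡ a + r + suc r
    shift = solve-∀

  good-if-end-light : ∀ {a R} → bit (heavy a) ≤ R → heavy (end a R) ≡ false → Good a R
  good-if-end-light {a} {R} valid eq rewrite eq = begin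
    mass a + suc (R + R)    ≡⟨ +-suc (mass a) (R + R) ⟩
    suc (mass a + (R + R))  ≤⟨ s≤s (mass-end valid) ⟩
    suc (mass (end a R))    ≤⟨ mass-< (end a R) ⟩
    mass (suc (end a R))    ∎
    where open ≤-Reasoning

  radius-zero-good : ∀ {a} → bit (heavy a) ≤ 0 → Good a 0
  radius-zero-good {a} valid = good-if-end-light valid end-light
    where
    a-light : heavy a ≡ false
    a-light = bit≡0 (n≤0⇒n≡0 valid)
    end-light : heavy (end a 0) ≡ false
    end-light = trans (cong heavy end≡a) a-light
      where
      end≡a : end a 0 ≡ a
      end≡a = trans (end-if-light a-light) (trans (+-identityʳ _) (+-identityʳ a))

  end-heavy-if-bad : ∀ {a R} → bit (heavy a) ≤ R → ¬ Good a R → heavy (end a R) ≡ true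
  end-heavy-if-bad valid bad = ¬-not (λ eq → bad (good-if-end-light valid eq))

  mass-if-bad : ∀ {a R} → bit (heavy a) ≤ R → ¬ Good a R → mass a + (R + R) + 3 ≤ mass m
  mass-if-bad {a} {R} valid bad = begin
    mass a + (R + R) + 3       ≤⟨ +-monoˡ-≤ 3 (mass-end valid) ⟩
    mass e + 3                 ≡⟨ +-comm (mass e) 3 ⟩
    suc (2 + mass e)           ≡⟨ cong suc (sym (mass-suc-heavy e-heavy)) ⟩
    suc (mass (suc e))         ≤⟨ mass-< (suc e) ⟩
    mass (suc (suc e))         ≤⟨ mass-mono ss-e≤m ⟩
    mass m                     ∎
    where
    open ≤-Reasoning
    e : ℕ
    e = end a R
    e-heavy : heavy e ≡ true
    e-heavy = end-heavy-if-bad valid bad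
    ss-e≤m : suc (suc e) ≤ m
    ss-e≤m with m ≤? suc e
    ... | yes m≤se with () ← trans (sym e-heavy) (last-light e m≤se)
    ... | no  m≰se = ≰⇒> m≰se

  light-if-mass-tight : ∀ e → mass (suc (suc e)) ≤ 2 + mass e →
    heavy e ≡ false × heavy (suc e) ≡ false
  light-if-mass-tight e tight =
    bit≡0 (m+n≡0⇒n≡0 (bit (heavy (suc e))) bits≡0) , bit≡0 (m+n≡0⇒m≡0 _ bits≡0)
    where
    regroup : ∀ x y z → suc (x + suc (y + z)) ≡ 2 + (x + y + z)
    regroup = solve-∀
    bits≡0 : bit (heavy (suc e)) + bit (heavy e) ≡ 0
    bits≡0 = n≤0⇒n≡0 (+-cancelʳ-≤ (mass e) _ 0 (+-cancelˡ-≤ 2 _ _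
      (subst (_≤ 2 + mass e) (regroup (bit (heavy (suc e))) (bit (heavy e)) (mass e)) tight)))

  bad-shape : ∀ {a r} → bit (heavy a) ≤ r → ¬ Good a (suc r) →
    heavy (end a r) ≡ false × heavy (suc (end a r)) ≡ false × heavy (suc (suc (end a r))) ≡ true
  bad-shape {a} {r} valid bad =
    let e-light , se-light = light-if-mass-tight e tight in e-light , se-light , ss-e-heavy
    where
    open ≤-Reasoning
    e : ℕ
    e = end a r
    valid′ : bit (heavy a) ≤ suc r
    valid′ = m≤n⇒m≤1+n valid
    ss-e-heavy : heavy (suc (suc e)) ≡ true
    ss-e-heavy = subst (λ x → heavy x ≡ true) (end-suc valid) (end-heavy-if-bad valid′ bad)
    regroup : ∀ x r → x + (suc r + suc r) ≡ 2 + (x + (r + r))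
    regroup = solve-∀
    tight : mass (suc (suc e)) ≤ 2 + mass e
    tight = begin
      mass (suc (suc e))        ≡⟨ cong mass (end-suc valid) ⟨
      mass (end a (suc r))      ≡⟨ cong mass (next-if-end-heavy (end-heavy-if-bad valid′ bad)) ⟨
      mass (next a (suc r))     ≤⟨ ≤-pred (≤-trans (≰⇒> bad) (≤-reflexive (+-suc (mass a) _))) ⟩
      mass a + (suc r + suc r)  ≡⟨ regroup (mass a) r ⟩
      2 + (mass a + (r + r))    ≤⟨ +-monoʳ-≤ 2 (mass-end valid) ⟩
      2 + mass e                ∎

  next-light-if-bad : ∀ {a r} → bit (heavy a) ≤ r → ¬ Good a (suc r) → heavy (next a r) ≡ false
  next-light-if-bad valid bad with e-light , se-light , _ ← bad-shape valid bad
    rewrite next-if-end-light e-light = se-light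

  mass-split-if-bad : ∀ {a r} → bit (heavy a) ≤ r → ¬ Good a (suc r) →
    mass a + 4 * suc r ≤ mass (next (next a r) (suc r))
  mass-split-if-bad {a} {r} valid bad with e-light , se-light , ss-e-heavy ← bad-shape valid bad
    rewrite next-if-end-light e-light = begin
      mass a + 4 * suc r                 ≡⟨ regroup (mass a) r ⟩
      4 + (mass a + (r + r)) + (r + r)   ≤⟨ +-monoˡ-≤ (r + r) (+-monoʳ-≤ 4 (mass-end valid)) ⟩
      4 + mass e + (r + r)               ≡⟨ cong (_+ (r + r)) (sym mass-sss-e) ⟩
      mass (3 + e) + (r + r)             ≤⟨ mass-+ (3 + e) (r + r) ⟩
      mass (3 + e + (r + r))             ≡⟨ cong mass (trans (end-if-light se-light) (shift e r)) ⟨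
      mass (end (suc e) (suc r))         ≤⟨ mass-mono (end≤next (suc e) (suc r)) ⟩
      mass (next (suc e) (suc r))        ∎
    where
    open ≤-Reasoning
    e : ℕ
    e = end a r
    regroup : ∀ x r → x + 4 * suc r ≡ 4 + (x + (r + r)) + (r + r)
    regroup = solve-∀
    shift : ∀ e r → suc e + suc r + suc r ≡ 3 + e + (r + r)
    shift = solve-∀
    mass-sss-e : mass (3 + e) ≡ 4 + mass e
    mass-sss-e = begin-equality
      mass (3 + e)        ≡⟨ mass-suc-heavy ss-e-heavy ⟩
      2 + mass (2 + e)    ≡⟨ cong (2 +_) (mass-suc-light se-light) ⟩
      3 + mass (1 + e)    ≡⟨ cong (3 +_) (mass-suc-light e-light) ⟩
      4 + mass e          ∎

  Covers : (ℕ → Set) → ℕ → Set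
  Covers Allowed a = Σ (ℕ → ℕ) λ centres → ∀ p → a ≤ p → p < m →
                       ∃ λ R → Allowed R × Burns (centres R) R p

  covers-beyond : ∀ {A a} → m ≤ a → Covers A a
  covers-beyond m≤a = (λ _ → 0) , λ p a≤p p<m → ⊥-elim (<⇒≱ p<m (≤-trans m≤a a≤p))

  covers-weaken : ∀ {A B a} → (∀ {R} → A R → B R) → Covers A a → Covers B a
  covers-weaken A⇒B (centres , covers) = centres , λ p a≤p p<m →
    let R , allowed , burns = covers p a≤p p<m in R , A⇒B allowed , burns

  covers-block : ∀ {A a R} → bit (heavy a) ≤ R → ¬ A R →
    Covers A (next a R) → Covers (λ x → x ≡ R ⊎ A x) a
  covers-block {A} {a} {R} valid R∉A (centres , covers) = centres [ R ≔ centre a R ] , covers′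
    where
    covers′ : ∀ p → a ≤ p → p < m →
      ∃ λ x → (x ≡ R ⊎ A x) × Burns ((centres [ R ≔ centre a R ]) x) x p
    covers′ p a≤p p<m with p <? next a R
    ... | yes p<next = R , inj₁ refl ,
      subst (λ c → Burns c R p) (sym (≔-same centres R)) (burns-block valid a≤p p<next)
    ... | no p≮next with x , allowed , burns ← covers p (≮⇒≥ p≮next) p<m =
      x , inj₂ allowed ,
      subst (λ c → Burns c x p) (sym (≔-other centres λ { refl → R∉A allowed })) burns

  radius-valid : ∀ {a j} → a < m → mass m ≤ mass a + suc j * suc j → bit (heavy a) ≤ j
  radius-valid {a} {j} a<m budget with heavy a in eq
  ... | false = z≤n
  radius-valid {a} {suc j} a<m budget | true = s≤s z≤n
  radius-valid {a} {zero} a<m budget | true = ⊥-elim (1+n≰n (begin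
    2 + mass a      ≡⟨ sym (mass-suc-heavy eq) ⟩
    mass (suc a)    ≤⟨ mass-mono a<m ⟩
    mass m          ≤⟨ budget ⟩
    mass a + 1      ≡⟨ +-comm (mass a) 1 ⟩
    1 + mass a      ∎))
    where open ≤-Reasoning

  radius-valid-if-bad : ∀ {a r} → ¬ Good a (suc r) →
    mass m ≤ mass a + suc (suc r) * suc (suc r) → bit (heavy a) ≤ r
  radius-valid-if-bad {a} {suc r} bad budget = ≤-trans (bit≤1 (heavy a)) (s≤s z≤n)
  radius-valid-if-bad {a} {zero}  bad budget = ⊥-elim (1+n≰n (begin
    suc (mass a + 4)  ≡⟨ +-suc (mass a) 4 ⟨
    mass a + 5        ≡⟨ +-assoc (mass a) 2 3 ⟨
    mass a + 2 + 3    ≤⟨ mass-if-bad (bit≤1 (heavy a)) bad ⟩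
    mass m            ≤⟨ budget ⟩
    mass a + 4        ∎))
    where open ≤-Reasoning

  budget-after-good : ∀ {a j} → Good a j → mass m ≤ mass a + suc j * suc j →
    mass m ≤ mass (next a j) + j * j
  budget-after-good {a} {j} good budget =
    budget-after (mass a) (suc (j + j)) good (subst (λ x → mass m ≤ mass a + x) (square j) budget)
    where
    square : ∀ j → suc j * suc j ≡ suc (j + j) + j * j
    square = solve-∀

  budget-after-split : ∀ {a r b} → mass a + 4 * suc r ≤ mass b →
    mass m ≤ mass a + suc (suc r) * suc (suc r) → mass m ≤ mass b + r * r
  budget-after-split {a} {r} used budget =
    budget-after (mass a) (4 * suc r) used (subst (λ x → mass m ≤ mass a + x) (square r) budget)
    where
    square : ∀ r → suc (suc r) * suc (suc r) ≡ 4 * suc r + r * r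
    square = solve-∀

  mutual
    cover : ∀ j a → mass m ≤ mass a + j * j → Covers (_< j) a
    cover j a budget with m ≤? a
    ... | yes m≤a = covers-beyond m≤a
    ... | no  m≰a = cover-from j a (≰⇒> m≰a) budget

    cover-from : ∀ j a → a < m → mass m ≤ mass a + j * j → Covers (_< j) a
    cover-from zero a a<m budget =
      ⊥-elim (<⇒≱ (≤-trans (mass-< a) (mass-mono a<m))
                  (subst (mass m ≤_) (+-identityʳ (mass a)) budget))
    cover-from (suc j) a a<m budget with good? a j
    ... | yes good = covers-weaken [ (λ { refl → n<1+n j }) , m<n⇒m<1+n ]′
      (covers-block (radius-valid a<m budget) (<-irrefl refl)
        (cover j (next a j) (budget-after-good good budget)))
    cover-from (suc zero) a a<m budget | no bad =
      ⊥-elim (bad (radius-zero-good (radius-valid a<m budget)))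
    -- Radius r + 1 is postponed: radius r covers from a, radius r + 1 right after it.
    cover-from (suc (suc r)) a a<m budget | no bad =
      covers-weaken below (covers-block valid r-fresh (covers-block valid′ sr-fresh rest))
      where
      valid : bit (heavy a) ≤ r
      valid = radius-valid-if-bad bad budget
      valid′ : bit (heavy (next a r)) ≤ suc r
      valid′ = subst (λ b → bit b ≤ suc r) (sym (next-light-if-bad valid bad)) z≤n
      rest : Covers (_< r) (next (next a r) (suc r))
      rest = cover r _ (budget-after-split (mass-split-if-bad valid bad) budget)
      sr-fresh : ¬ suc r < r
      sr-fresh sr<r = <-asym sr<r (n<1+n r)
      r-fresh : ¬ (r ≡ suc r ⊎ r < r)
      r-fresh (inj₁ r≡sr) = 1+n≰n (≤-reflexive (sym r≡sr))
      r-fresh (inj₂ r<r)  = <-irrefl refl r<r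
      below : ∀ {x} → x ≡ r ⊎ (x ≡ suc r ⊎ x < r) → x < suc (suc r)
      below (inj₁ refl)         = m<n⇒m<1+n (n<1+n r)
      below (inj₂ (inj₁ refl))  = n<1+n (suc r)
      below (inj₂ (inj₂ x<r))   = m<n⇒m<1+n (m<n⇒m<1+n x<r)

  cover-spine : ∀ k → 0 < m → mass m ≤ k * k →
    Σ (ℕ → ℕ) λ centres → (∀ R → centres R < m) ×
      (∀ p → p < m → ∃ λ R → R < k × Burns (centres R) R p)
  cover-spine k 0<m budget with centres , covers ← cover k 0 budget =
    (λ R → centres R ⊓ pred m) ,
    (λ R → ≤-<-trans (m⊓n≤n (centres R) (pred m)) (pred[n]<n 0<m)) ,
    λ p p<m → let R , R<k , burns = covers p z≤n p<m in R , R<k , burns-clamp p<m burns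

unique-lookup-injective : ∀ {A : Set} {xs : List A} → Unique xs →
  ∀ i j → lookup xs i ≡ lookup xs j → i ≡ j
unique-lookup-injective (x∉ ∷ _) fzero    fzero    _  = refl
unique-lookup-injective (x∉ ∷ _) fzero    (fsuc j) eq = ⊥-elim (All.lookup x∉ (∈-lookup j) eq)
unique-lookup-injective (x∉ ∷ _) (fsuc i) fzero    eq = ⊥-elim (All.lookup x∉ (∈-lookup i) (sym eq))
unique-lookup-injective (_ ∷ u)  (fsuc i) (fsuc j) eq = cong fsuc (unique-lookup-injective u i j eq)

unique-length≤ : ∀ {n} {xs : List (Fin n)} → Unique xs → length xs ≤ n
unique-length≤ u = injective⇒≤ (unique-lookup-injective u _ _)

k∸[1+k∸[1+R]]≡R : ∀ {R k} → R < k → k ∸ suc (k ∸ suc R) ≡ R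
k∸[1+k∸[1+R]]≡R {R} {suc k} (s≤s R≤k) = m∸[m∸n]≡n R≤k

module _ {n : ℕ} (G : Graph n) where

  walk-snoc : ∀ {u v w l} → Walk G u v l → Adj G v w → Walk G u w (suc l)
  walk-snoc here         adj = step adj here
  walk-snoc (step e wk) adj = step e (walk-snoc wk adj)

  walk-reverse : ∀ {u v l} → Walk G u v l → Walk G v u l
  walk-reverse here         = here
  walk-reverse (step e wk) = walk-snoc (walk-reverse wk) (Graph.sym G e)

  burnable-by-radii : ∀ k (centres : ℕ → Fin n) →
    (∀ v → ∃ λ R → R < k × DistLe G (centres R) v R) → Burnable G k
  burnable-by-radii k centres reach = (λ i → centres (k ∸ suc (toℕ i))) , burning
    where
    burning : BurningSeq G k (λ i → centres (k ∸ suc (toℕ i)))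
    burning v with R , R<k , dist ← reach v =
      fromℕ< i<k , subst (λ r → DistLe G (centres r) v r) (sym index-radius) dist
      where
      i<k : k ∸ suc R < k
      i<k = ∸-monoʳ-< (s≤s z≤n) R<k
      index-radius : k ∸ suc (toℕ (fromℕ< i<k)) ≡ R
      index-radius rewrite toℕ-fromℕ< i<k = k∸[1+k∸[1+R]]≡R R<k

-- Positions past the end of the list read the junk vertex fzero.
at : ∀ {n} → List (Fin (suc n)) → ℕ → Fin (suc n)
at []       _       = fzero
at (x ∷ xs) zero    = x
at (x ∷ xs) (suc i) = at xs i

module _ {n : ℕ} where

  any-at : ∀ {P : Fin (suc n) → Set} {xs} → Any P xs → ∃ λ p → p < length xs × P (at xs p)
  any-at (here px)  = 0 , s≤s z≤n , px
  any-at (there pxs) with p , p<len , px ← any-at pxs = suc p , s≤s p<len , px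

  at-++ : ∀ (xs ys : List (Fin (suc n))) {p} → p < length xs → at (xs ++ ys) p ≡ at xs p
  at-++ (x ∷ xs) ys {zero}  _           = refl
  at-++ (x ∷ xs) ys {suc p} (s≤s p<len) = at-++ xs ys p<len

module _ {n : ℕ} (G : Graph (suc n)) where

  -- `anchor v` is the spine position that v hangs from; with slack 1 it is never the last one.
  Anchoring : ℕ → List (Fin (suc n)) → (Fin (suc n) → ℕ) → Set
  Anchoring slack spine anchor =
    ∀ v → v ∉ spine → slack + anchor v < length spine × Adj G v (at spine (anchor v))

  chain-adj : ∀ {xs i} → Chain G xs → suc i < length xs → Adj G (at xs i) (at xs (suc i))
  chain-adj {x ∷ y ∷ ys} {zero}  (adj , _)   _           = adj
  chain-adj {x ∷ y ∷ ys} {suc i} (_ , chain) (s≤s i<len) = chain-adj chain i<len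
  chain-adj {x ∷ []}     {_}     _           (s≤s ())

  chain-walk : ∀ {xs} → Chain G xs → ∀ i d → i + d < length xs → Walk G (at xs i) (at xs (i + d)) d
  chain-walk chain i zero    _ rewrite +-identityʳ i = here
  chain-walk {xs} chain i (suc d) i+d<len =
    subst (λ j → Walk G (at xs i) (at xs j) (suc d)) (sym (+-suc i d))
      (step (chain-adj chain (≤-<-trans (s≤s (m≤m+n i d)) bound))
            (chain-walk chain (suc i) d bound))
    where
    bound : suc (i + d) < length xs
    bound = subst (_< length xs) (+-suc i d) i+d<len

  chain-dist : ∀ {xs c p R} → Chain G xs → c < length xs → p < length xs →
    c ≤ p + R → p ≤ c + R → DistLe G (at xs c) (at xs p) R
  chain-dist {xs} {c} {p} {R} chain c<len p<len c≤p+R p≤c+R with ≤-total c p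
  ... | inj₁ c≤p with d , refl ← m≤n⇒∃[o]m+o≡n c≤p =
    d , +-cancelˡ-≤ c d R p≤c+R , chain-walk chain c d p<len
  ... | inj₂ p≤c with d , refl ← m≤n⇒∃[o]m+o≡n p≤c =
    d , +-cancelˡ-≤ p d R c≤p+R , walk-reverse G (chain-walk chain p d c<len)

  chain-snoc : ∀ {xs w} → Chain G xs → 0 < length xs → Adj G (at xs (pred (length xs))) w →
    Chain G (xs ++ w ∷ [])
  chain-snoc {x ∷ []}     _           _ adj = adj , tt
  chain-snoc {x ∷ y ∷ ys} (adj′ , chain) _ adj = adj′ , chain-snoc chain (s≤s z≤n) adj

module SpineBurning {n : ℕ} (G : Graph (suc n)) (spine : List (Fin (suc n)))
  (chain : Chain G spine) (unique : Unique spine)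
  (anchor : Fin (suc n) → ℕ) (anchored : Anchoring G 1 spine anchor) where

  open import Data.List.Membership.DecPropositional (Fin._≟_ {suc n}) using (_∈?_)

  LeafAt : ℕ → Fin (suc n) → Set
  LeafAt p v = v ∉ spine × anchor v ≡ p

  leaf? : ∀ p → Dec (∃ (LeafAt p))
  leaf? p = any? λ v → ¬? (v ∈? spine) ×-dec (anchor v ≟ p)

  heavy : ℕ → Bool
  heavy p with leaf? p
  ... | yes _ = true
  ... | no  _ = false

  last-light : ∀ p → length spine ≤ suc p → heavy p ≡ false
  last-light p len≤sp with leaf? p
  ... | yes (v , v∉ , refl) = ⊥-elim (<⇒≱ (proj₁ (anchored v v∉)) len≤sp)
  ... | no  _               = refl

  anchor-heavy : ∀ {v} → v ∉ spine → heavy (anchor v) ≡ true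
  anchor-heavy {v} v∉ with leaf? (anchor v)
  ... | yes _     = refl
  ... | no  ¬leaf = ⊥-elim (¬leaf (v , v∉ , refl))

  open Covering (length spine) heavy last-light

  leaf-at : ℕ → List (Fin (suc n))
  leaf-at p with leaf? p
  ... | yes (v , _) = v ∷ []
  ... | no  _       = []

  length-leaf-at : ∀ p → length (leaf-at p) ≡ bit (heavy p)
  length-leaf-at p with leaf? p
  ... | yes _ = refl
  ... | no  _ = refl

  leaf-at-is-leaf : ∀ p → All (LeafAt p) (leaf-at p)
  leaf-at-is-leaf p with leaf? p
  ... | yes (_ , leaf) = leaf ∷ []
  ... | no  _          = []

  leaf-at-unique : ∀ p → Unique (leaf-at p)
  leaf-at-unique p with leaf? p
  ... | yes _ = [] ∷ []
  ... | no  _ = []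

  leaves-below : ℕ → List (Fin (suc n))
  leaves-below zero    = []
  leaves-below (suc p) = leaf-at p ++ leaves-below p

  leaves-below-are-below : ∀ p → All (λ v → v ∉ spine × anchor v < p) (leaves-below p)
  leaves-below-are-below zero    = []
  leaves-below-are-below (suc p) = All.++⁺
    (All.map (λ { (v∉ , refl) → v∉ , n<1+n _ }) (leaf-at-is-leaf p))
    (All.map (λ (v∉ , v<p) → v∉ , m<n⇒m<1+n v<p) (leaves-below-are-below p))

  leaves-below-unique : ∀ p → Unique (leaves-below p)
  leaves-below-unique zero    = []
  leaves-below-unique (suc p) = Unique.++⁺ (leaf-at-unique p) (leaves-below-unique p) disjoint
    where
    disjoint : ∀ {v} → ¬ (v ∈ leaf-at p × v ∈ leaves-below p)
    disjoint (v∈leaf , v∈leaves) with _ , refl ← All.lookup (leaf-at-is-leaf p) v∈leaf =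
      <-irrefl refl (proj₂ (All.lookup (leaves-below-are-below p) v∈leaves))

  mass≡+leaves-below : ∀ p → mass p ≡ p + length (leaves-below p)
  mass≡+leaves-below zero    = refl
  mass≡+leaves-below (suc p) = cong suc (begin
    bit (heavy p) + mass p
      ≡⟨ cong₂ _+_ (sym (length-leaf-at p)) (mass≡+leaves-below p) ⟩
    length (leaf-at p) + (p + length (leaves-below p))
      ≡⟨ x∙yz≈y∙xz (length (leaf-at p)) p _ ⟩
    p + (length (leaf-at p) + length (leaves-below p))
      ≡⟨ cong (p +_) (length-++ (leaf-at p)) ⟨
    p + length (leaves-below (suc p))
      ∎)
    where open ≡-Reasoning

  mass-spine≤ : mass (length spine) ≤ suc n
  mass-spine≤ = begin
    mass (length spine)                           ≡⟨ mass≡+leaves-below (length spine) ⟩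
    length spine + length leaves                  ≡⟨ length-++ spine ⟨
    length (spine ++ leaves)                      ≤⟨ unique-length≤ spine-leaves-unique ⟩
    suc n                                         ∎
    where
    open ≤-Reasoning
    leaves : List (Fin (suc n))
    leaves = leaves-below (length spine)
    spine-leaves-unique : Unique (spine ++ leaves)
    spine-leaves-unique = Unique.++⁺ unique (leaves-below-unique (length spine)) λ (v∈spine , v∈leaves) →
      proj₁ (All.lookup (leaves-below-are-below (length spine)) v∈leaves) v∈spine

  spine-nonempty : 0 < length spine
  spine-nonempty with fzero ∈? spine
  ... | yes v∈ = ≤-trans (s≤s z≤n) (proj₁ (proj₂ (any-at v∈)))
  ... | no  v∉ = ≤-trans (s≤s z≤n) (proj₁ (anchored fzero v∉))

  burnable : ∀ k → suc n ≤ k * k → Burnable G k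
  burnable k n≤k²
    with centres , centres<len , covers ← cover-spine k spine-nonempty (≤-trans mass-spine≤ n≤k²) =
    burnable-by-radii G k (λ R → at spine (centres R)) reach
    where
    reach : ∀ v → ∃ λ R → R < k × DistLe G (at spine (centres R)) v R
    reach v with v ∈? spine
    ... | yes v∈ with p , p<len , refl ← any-at v∈ with R , R<k , burns ← covers p p<len =
      let c≤ , p≤ = burns-spine burns in
      R , R<k , chain-dist G chain (centres<len R) p<len c≤ p≤
    ... | no v∉ with sp<len , adj ← anchored v v∉
                with R , R<k , burns ← covers (anchor v) (<-trans (n<1+n _) sp<len)
                with R′ , refl , c≤ , p≤ ← burns-leaves (anchor-heavy v∉) burns =
      let l , l≤R′ , walk = chain-dist G chain (centres<len R) (<-trans (n<1+n _) sp<len) c≤ p≤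
      in R , R<k , suc l , s≤s l≤R′ , walk-snoc G walk (Graph.sym G adj)

m<n∧m≢pred[n]⇒1+m<n : ∀ {m n} → m < n → m ≢ pred n → suc m < n
m<n∧m≢pred[n]⇒1+m<n m<n m≢ with m≤n⇒m<n∨m≡n m<n
... | inj₁ 1+m<n = 1+m<n
... | inj₂ refl  = ⊥-elim (m≢ refl)

module _ {n : ℕ} (G : Graph (suc n)) where

  open import Data.List.Membership.DecPropositional (Fin._≟_ {suc n}) using (_∈?_)

  -- The covering argument needs the last spine vertex to carry nothing; otherwise one of the
  -- vertices hanging from it becomes the new last spine vertex.
  extend-spine : ∀ {spine} (anchor : Fin (suc n) → ℕ) → Chain G spine → Unique spine →
    Anchoring G 0 spine anchor →
    ∃ λ (spine′ : List (Fin (suc n))) → Chain G spine′ × Unique spine′ × Anchoring G 1 spine′ anchor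
  extend-spine {spine} anchor chain unique anchored
    with any? (λ v → ¬? (v ∈? spine) ×-dec (anchor v ≟ pred (length spine)))
  ... | no no-last-leaf = spine , chain , unique , λ v v∉ →
    let a<len , adj = anchored v v∉
    in m<n∧m≢pred[n]⇒1+m<n a<len (λ eq → no-last-leaf (v , v∉ , eq)) , adj
  ... | yes (w , w∉ , w-last) = spine ++ w ∷ [] , chain′ , unique′ , anchored′
    where
    w-adj : anchor w < length spine × Adj G w (at spine (anchor w))
    w-adj = anchored w w∉
    chain′ : Chain G (spine ++ w ∷ [])
    chain′ = chain-snoc G chain (≤-trans (s≤s z≤n) (proj₁ w-adj))
      (subst (λ p → Adj G (at spine p) w) w-last (Graph.sym G (proj₂ w-adj)))
    unique′ : Unique (spine ++ w ∷ [])
    unique′ = Unique.++⁺ unique ([] ∷ []) λ { (w∈ , here refl) → w∉ w∈ }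
    anchored′ : Anchoring G 1 (spine ++ w ∷ []) anchor
    anchored′ v v∉′ =
      let a<len , adj = anchored v (v∉′ ∘ ∈-++⁺ˡ) in
      subst (suc (anchor v) <_) (trans (+-comm 1 _) (sym (length-++ spine))) (s≤s a<len) ,
      subst (Adj G v) (sym (at-++ spine (w ∷ []) a<len)) adj

  dominating-path-burnable : ∀ {spine k} → Chain G spine → Unique spine →
    (∀ v → v ∈ spine ⊎ Any (Adj G v) spine) → suc n ≤ k * k → Burnable G k
  dominating-path-burnable {spine} {k} chain unique dominated n≤k² =
    let spine′ , chain′ , unique′ , anchored′ = extend-spine anchor chain unique anchored
    in SpineBurning.burnable G spine′ chain′ unique′ anchor anchored′ k n≤k²
    where
    anchor : Fin (suc n) → ℕ
    anchor v with dominated v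
    ... | inj₁ _   = 0
    ... | inj₂ adj = proj₁ (any-at adj)
    anchored : Anchoring G 0 spine anchor
    anchored v v∉ with dominated v
    ... | inj₁ v∈  = ⊥-elim (v∉ v∈)
    ... | inj₂ adj = proj₂ (any-at adj)

ceilSqrtFrom-spec : ∀ n s fuel → n ≤ (s + fuel) * (s + fuel) →
  n ≤ ceilSqrtFrom n s fuel * ceilSqrtFrom n s fuel
ceilSqrtFrom-spec n s zero       n≤ = subst (λ x → n ≤ x * x) (+-identityʳ s) n≤
ceilSqrtFrom-spec n s (suc fuel) n≤ with n ≤? s * s
... | yes n≤s² = n≤s²
... | no  _    = ceilSqrtFrom-spec n (suc s) fuel (subst (λ x → n ≤ x * x) (+-suc s fuel) n≤)

ceilSqrt-spec : ∀ n → n ≤ ceilSqrt n * ceilSqrt n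
ceilSqrt-spec zero    = z≤n
ceilSqrt-spec (suc n) = ceilSqrtFrom-spec (suc n) 0 (suc n) (m≤m*n (suc n) (suc n))

mainTheorem1 : (n : ℕ) (G : Graph n) → IsCaterpillar G → BurningNumberLe G (ceilSqrt n)
mainTheorem1 zero    G _ = 0 , z≤n , (λ ()) , (λ ())
mainTheorem1 (suc n) G (_ , spine , (chain , unique) , dominated) =
  ceilSqrt (suc n) , ≤-refl ,
  dominating-path-burnable G chain unique dominated (ceilSqrt-spec (suc n))
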